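{- Let $\bm\lambda=(R_1,\dots,R_n)$ be a horizontal-strip with a strict sequence of rows $(R_{j_1},\dots,R_{j_k})$. Suppose that for some $1\le t\le k-1$ there is an index $x$ with $j_t<x<j_{t+1}$, $l(R_x)=l(R_{j_{t+1}})$ and $R_{j_{t+1}}\precnsim R_x$. Then one of the following holds: (1) the sequence $(R_{j_1},\dots,R_{j_t},R_x)$ is strict; (2) there is a shorter strict sequence of the form $(R_{j_1},\dots,R_{j_t},R_x,R_{j_{t'}},\dots,R_{j_k})$ for some $t'\ge t+2$; (3) there is a strict pair $(R_x,R_{j_{t'+1}})$ for some $t'\ge t+1$.
   Context: A row is $R=a/b=\{(1,j):b+1\le j\le a\}$ ($a\ge b\ge0$ integers); $l(R)=b$, $r(R)=a-1$, $|R|$ its number of cells, $R^+=(a+1)/(b+1)$. For rows $R,R'$: $M(R,R')=|R\cap R'|$ if $l(R)\le l(R')$, else $|R\cap R'^+|$. For a horizontal-strip (sequence of rows) $(R_1,\dots,R_n)$, $M_{i,j}=M(R_{\min(i,j)},R_{\max(i,j)})$ for $i\ne j$; $R_i\prec R_j$ means $M_{i,j}=|R_i|$, and $R_i\precnsim R_j$ means $R_i\prec R_j$ but not $R_j\prec R_i$. A pair $(R_i,R_j)$ with $i<j$ and $l(R_i)<l(R_j)$ is strict if either $0<M_{i,j}<\min\{|R_i|,|R_j|\}$, or $M_{i,j}=0$ and $M_{i,k}+M_{j,k}\ge|R_k|+1$ for some $k\notin\{i,j\}$. A strict sequence is a sequence of rows $(R_{j_1},\dots,R_{j_k})$ with $k\ge2$,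 $j_1<\dots<j_k$, $M_{j_t,j_{t'}}=0$ for all $1\le t<t'\le k$, and such that there exists $h$ with $h<j_1$ or $h>j_k$ for which $M_{j_t,h}>0$ for all $1\le t\le k$ and $M_{j_1,h}+\dots+M_{j_k,h}\ge|R_h|+1$. -}

module Defs where

open import Data.Nat using (ℕ; zero; suc; _+_; _∸_; _≤_; _<_; _⊓_; _⊔_; s≤s; _≤?_)
open import Data.Fin as Fin using (Fin; toℕ)
open import Data.List using (List; []; _∷_; length; map)
open import Data.Nat.ListAction using (sum)
open import Data.List.Relation.Unary.All using (All)
open import Data.List.Relation.Unary.AllPairs using (AllPairs)
open import Data.List.Relation.Unary.Linked using (Linked)
open import Data.Product using (Σ; ∃; _×_; _,_)
open import Data.Sum using (_⊎_)
open import Relation.Nullary using (¬_; yes; no)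
open import Relation.Binary.PropositionalEquality using (_≡_; _≢_)

-- A row a/b = {(1,j) : b+1 ≤ j ≤ a}, with a ≥ b ≥ 0.
record Row : Set where
  constructor mkRow
  field
    a   : ℕ
    b   : ℕ
    b≤a : b ≤ a
open Row public

l : Row → ℕ
l R = b R

r : Row → ℕ
r R = a R ∸ 1

∣_∣ᵣ : Row → ℕ
∣ R ∣ᵣ = a R ∸ b R

_⁺ : Row → Row
mkRow a' b' p ⁺ = mkRow (suc a') (suc b') (s≤s p)

-- |R ∩ R'| : the intervals [b+1,a] and [b'+1,a'] meet in
-- max(0, min(a,a') - max(b,b')) cells.
∣_∩_∣ : Row → Row → ℕ
∣ R ∩ R' ∣ = (a R ⊓ a R') ∸ (b R ⊔ b R')

M : Row → Row → ℕ
M R R' with l R ≤? l R'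
... | yes _ = ∣ R ∩ R' ∣
... | no  _ = ∣ R ∩ (R' ⁺) ∣

Strip : ℕ → Set
Strip n = Fin n → Row

-- M_{i,j} = M(R_{min(i,j)}, R_{max(i,j)})  (used only for i ≠ j)
Mat : ∀ {n} → Strip n → Fin n → Fin n → ℕ
Mat λ' i j with toℕ i ≤? toℕ j
... | yes _ = M (λ' i) (λ' j)
... | no  _ = M (λ' j) (λ' i)

_⊢_≺_ : ∀ {n} → Strip n → Fin n → Fin n → Set
λ' ⊢ i ≺ j = Mat λ' i j ≡ ∣ λ' i ∣ᵣ

_⊢_≺≁_ : ∀ {n} → Strip n → Fin n → Fin n → Set
λ' ⊢ i ≺≁ j = (λ' ⊢ i ≺ j) × ¬ (λ' ⊢ j ≺ i)

StrictPair : ∀ {n} → Strip n → Fin n → Fin n → Set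
StrictPair λ' i j =
  (i Fin.< j) × (l (λ' i) < l (λ' j)) ×
  ( ((0 < Mat λ' i j) × (Mat λ' i j < ∣ λ' i ∣ᵣ ⊓ ∣ λ' j ∣ᵣ))
  ⊎ ((Mat λ' i j ≡ 0) ×
     ∃ λ k → (k ≢ i) × (k ≢ j) × (∣ λ' k ∣ᵣ + 1 ≤ Mat λ' i k + Mat λ' j k)))

-- (R_{j_1},…,R_{j_k}) is a strict sequence; js = [j_1,…,j_k].
-- Since js is strictly increasing, "h < j_1 or h > j_k" is stated as
-- "h is below all j_t or above all j_t".
StrictSeq : ∀ {n} → Strip n → List (Fin n) → Set
StrictSeq λ' js =
  (2 ≤ length js) ×
  Linked Fin._<_ js ×
  AllPairs (λ i j → Mat λ' i j ≡ 0) js ×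
  ∃ λ h → (All (h Fin.<_) js ⊎ All (Fin._< h) js) ×
          All (λ j → 0 < Mat λ' j h) js ×
          (∣ λ' h ∣ᵣ + 1 ≤ sum (map (λ j → Mat λ' j h) js))

-- The rows of a strict sequence with witness h are pairwise disjoint, and each meets R h in at
-- most its cells in a window of |R h| + 1 cells: R h together with its neighbouring cell on the
-- side of the sequence. As these overlaps add up to at least |R h| + 1, the rows tile the window,
-- which forces them to be ordered from left to right. Now R x starts where R v = R_{j_{t+1}}
-- starts and, as R x ⊀ R v, ends further right; so R v and the following rows lying inside R x
-- meet R h in at most what R x does, and can be replaced by R x. The first later row not inside
-- R x either overlaps it partially, a strict pair, or starts after R x ends, as do all the rows
-- after it, which leaves a strict sequence.

module Submission where

open import Defs
open import Data.Nat
open import Data.Nat.Properties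
open import Data.Nat.ListAction using (sum)
open import Data.Nat.ListAction.Properties using (sum-++)
open import Data.Fin as Fin using (Fin; toℕ)
open import Data.Fin.Properties
  using () renaming (<-trans to <ᶠ-trans; <-cmp to <ᶠ-cmp; <-asym to <ᶠ-asym)
open import Data.List using (List; []; _∷_; _++_; map; length)
open import Data.List.Properties using (map-++)
open import Data.List.Membership.Propositional using (_∈_; find)
open import Data.List.Membership.Propositional.Properties using (∈-++⁺ˡ; ∈-++⁺ʳ; ∈-++⁻)
open import Data.List.Relation.Unary.All as All using (All; []; _∷_)
open import Data.List.Relation.Unary.All.Properties as All using (¬Any⇒All¬)
open import Data.List.Relation.Unary.Any using (Any; here; there; any?)
open import Data.List.Relation.Unary.AllPairs as AllPairs using (AllPairs; []; _∷_)
open import Data.List.Relation.Unary.Linked using (Linked; []; [-]; _∷_)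
open import Data.List.Relation.Unary.Linked.Properties using (Linked⇒AllPairs)
open import Data.Product using (∃; _×_; _,_)
open import Data.Sum using (_⊎_; inj₁; inj₂)
open import Data.Empty using (⊥-elim)
open import Function using (_on_)
open import Relation.Nullary using (¬_; Dec; yes; no; contradiction)
open import Relation.Nullary.Decidable using (_×-dec_)
open import Relation.Binary.Definitions using (Transitive; tri<; tri≈; tri>)
open import Relation.Binary.PropositionalEquality
  using (_≡_; _≢_; refl; sym; trans; cong; cong₂; subst; module ≡-Reasoning)

module _ {A : Set} where

  sum-map-++ : ∀ (f : A → ℕ) xs ys → sum (map f (xs ++ ys)) ≡ sum (map f xs) + sum (map f ys)
  sum-map-++ f xs ys = trans (cong sum (map-++ f xs ys)) (sum-++ (map f xs) (map f ys))

  sum-map-mono : ∀ {f g : A → ℕ} {L} → All (λ z → f z ≤ g z) L → sum (map f L) ≤ sum (map g L)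
  sum-map-mono []         = z≤n
  sum-map-mono (le ∷ les) = +-mono-≤ le (sum-map-mono les)

  length-≥2 : ∀ pre {u x : A} s → 2 ≤ length (pre ++ u ∷ x ∷ s)
  length-≥2 []        s = s≤s (s≤s z≤n)
  length-≥2 (_ ∷ pre) s = m≤n⇒m≤1+n (length-≥2 pre s)

  All-replace : ∀ {P : A → Set} pre p s {u v x} →
                All P (pre ++ u ∷ v ∷ p ++ s) → P x → All P (pre ++ u ∷ x ∷ s)
  All-replace []        p s (Pu ∷ _ ∷ rest) Px = Pu ∷ Px ∷ All.++⁻ʳ p rest
  All-replace (_ ∷ pre) p s (Pz ∷ rest)     Px = Pz ∷ All-replace pre p s rest Px

  module _ {P : A → A → Set} where

    AllPairs-++⁻ˡ : ∀ xs {ys} → AllPairs P (xs ++ ys) → AllPairs P xs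
    AllPairs-++⁻ˡ []       _           = []
    AllPairs-++⁻ˡ (_ ∷ xs) (Px ∷ Pxs) = All.++⁻ˡ xs Px ∷ AllPairs-++⁻ˡ xs Pxs

    AllPairs-++⁻ʳ : ∀ xs {ys} → AllPairs P (xs ++ ys) → AllPairs P ys
    AllPairs-++⁻ʳ []       Pys        = Pys
    AllPairs-++⁻ʳ (_ ∷ xs) (_ ∷ Pxs) = AllPairs-++⁻ʳ xs Pxs

    AllPairs-++-middle : ∀ xs {y ys} → AllPairs P (xs ++ y ∷ ys) → All (λ z → P z y) xs
    AllPairs-++-middle []       _           = []
    AllPairs-++-middle (_ ∷ xs) (Px ∷ Pxs) =
      All.lookup Px (∈-++⁺ʳ xs (here refl)) ∷ AllPairs-++-middle xs Pxs

  module _ {_≺_ : A → A → Set} (≺-trans : Transitive _≺_) where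

    Linked-weakenHead : ∀ {w z} ys → w ≺ z → Linked _≺_ (z ∷ ys) → Linked _≺_ (w ∷ ys)
    Linked-weakenHead []      _   _           = [-]
    Linked-weakenHead (_ ∷ _) w≺z (z≺y ∷ zys) = ≺-trans w≺z z≺y ∷ zys

    Linked-skip : ∀ {w} p s → Linked _≺_ (w ∷ p ++ s) → Linked _≺_ (w ∷ s)
    Linked-skip []      s ws          = ws
    Linked-skip (_ ∷ p) s (w≺z ∷ zps) = Linked-weakenHead s w≺z (Linked-skip p s zps)

    Linked-replace : ∀ pre p s {u v x} → Linked _≺_ (pre ++ u ∷ v ∷ p ++ s) →
                     u ≺ x → x ≺ v → Linked _≺_ (pre ++ u ∷ x ∷ s)
    Linked-replace []             p s (_ ∷ vps) u≺x x≺v =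
      u≺x ∷ Linked-weakenHead s x≺v (Linked-skip p s vps)
    Linked-replace (_ ∷ [])       p s (z≺u ∷ rest) u≺x x≺v =
      z≺u ∷ Linked-replace [] p s rest u≺x x≺v
    Linked-replace (_ ∷ z ∷ pre) p s (≺z ∷ rest) u≺x x≺v =
      ≺z ∷ Linked-replace (z ∷ pre) p s rest u≺x x≺v

OrderedPairs : ∀ {n} → (Fin n → Fin n → Set) → List (Fin n) → Set
OrderedPairs P L = ∀ {j k} → j ∈ L → k ∈ L → j Fin.< k → P j k

module _ {n} {P : Fin n → Fin n → Set} where

  AllPairs⇒OrderedPairs : ∀ {L} → AllPairs Fin._<_ L → AllPairs P L → OrderedPairs P L
  AllPairs⇒OrderedPairs (_ ∷ _)    (_ ∷ _)    (here refl) (here refl) j<j = ⊥-elim (<-irrefl refl j<j)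
  AllPairs⇒OrderedPairs (_ ∷ _)    (Pj ∷ _)   (here refl) (there k∈)  _   = All.lookup Pj k∈
  AllPairs⇒OrderedPairs (k< ∷ _)   (_ ∷ _)    (there j∈)  (here refl) k<j =
    contradiction (All.lookup k< j∈) (<ᶠ-asym k<j)
  AllPairs⇒OrderedPairs (_ ∷ <s)   (_ ∷ Ps)   (there j∈)  (there k∈)  j<k =
    AllPairs⇒OrderedPairs <s Ps j∈ k∈ j<k

  OrderedPairs⇒AllPairs : ∀ {L} → AllPairs Fin._<_ L → OrderedPairs P L → AllPairs P L
  OrderedPairs⇒AllPairs []         _  = []
  OrderedPairs⇒AllPairs (j< ∷ <s) OP =
    All.tabulate (λ k∈ → OP (here refl) (there k∈) (All.lookup j< k∈))
    ∷ OrderedPairs⇒AllPairs <s (λ j∈ k∈ → OP (there j∈) (there k∈))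

-- Cells of rows in a window

_∈ʳ_ : ℕ → Row → Set
c ∈ʳ R = b R < c × c ≤ a R

_∈ʳ?_ : ∀ c R → Dec (c ∈ʳ R)
c ∈ʳ? R = (b R <? c) ×-dec (c ≤? a R)

_⊆ʳ_ : Row → Row → Set
R ⊆ʳ S = b S ≤ b R × a R ≤ a S

Disjoint : Row → Row → Set
Disjoint R S = a R ≤ b S ⊎ a S ≤ b R

-- The extra cell of the second alternative is what M ≡ 0 gives when R starts after S.
Separated : Row → Row → Set
Separated R S = a R ≤ b S ⊎ a S < b R

Disjoint-∉ : ∀ {R S c} → Disjoint R S → c ∈ʳ R → ¬ c ∈ʳ S
Disjoint-∉ (inj₁ aR≤bS) (_ , c≤aR) (bS<c , _) = <⇒≱ bS<c (≤-trans c≤aR aR≤bS)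
Disjoint-∉ (inj₂ aS≤bR) (bR<c , _) (_ , c≤aS) = <⇒≱ bR<c (≤-trans c≤aS aS≤bR)

Separated⇒Disjoint : ∀ R S → Separated R S → Disjoint R S
Separated⇒Disjoint R S (inj₁ aR≤bS) = inj₁ aR≤bS
Separated⇒Disjoint R S (inj₂ aS<bR) = inj₂ (<⇒≤ aS<bR)

-- |R ∩ (lo, hi]|; in particular ∣ R ∩ S ∣ is cellsIn R (b S) (a S).
cellsIn : Row → ℕ → ℕ → ℕ
cellsIn R lo hi = (a R ⊓ hi) ∸ (b R ⊔ lo)

∩-comm : ∀ R S → ∣ R ∩ S ∣ ≡ ∣ S ∩ R ∣
∩-comm R S = cong₂ _∸_ (⊓-comm (a R) (a S)) (⊔-comm (b R) (b S))

cellsIn-empty : ∀ R {lo hi} → hi ≤ b R ⊔ lo → cellsIn R lo hi ≡ 0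
cellsIn-empty R {lo} {hi} hi≤ = m≤n⇒m∸n≡0 (≤-trans (m⊓n≤n (a R) hi) hi≤)

cellsIn-mono-hi : ∀ R {lo hi hi′} → hi ≤ hi′ → cellsIn R lo hi ≤ cellsIn R lo hi′
cellsIn-mono-hi R {lo} hi≤hi′ = ∸-monoˡ-≤ (b R ⊔ lo) (⊓-monoʳ-≤ (a R) hi≤hi′)

cellsIn-lo-irrelevant : ∀ R {lo lo′ hi} → lo ≤ b R → lo′ ≤ b R → cellsIn R lo hi ≡ cellsIn R lo′ hi
cellsIn-lo-irrelevant R {hi = hi} lo≤bR lo′≤bR =
  cong ((a R ⊓ hi) ∸_) (trans (m≥n⇒m⊔n≡m lo≤bR) (sym (m≥n⇒m⊔n≡m lo′≤bR)))

cellsIn-restrict : ∀ {R S} lo hi → R ⊆ʳ S → cellsIn R lo hi ≡ cellsIn R (b S ⊔ lo) (a S ⊓ hi)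
cellsIn-restrict {R} {S} lo hi (bS≤bR , aR≤aS) = cong₂ _∸_
  (trans (cong (_⊓ hi) (sym (m≤n⇒m⊓n≡m aR≤aS))) (⊓-assoc (a R) (a S) hi))
  (trans (cong (_⊔ lo) (sym (m≥n⇒m⊔n≡m bS≤bR))) (⊔-assoc (b R) (b S) lo))

cellsIn-suc-∈ : ∀ R {lo hi} → lo ≤ hi → suc hi ∈ʳ R → cellsIn R lo (suc hi) ≡ suc (cellsIn R lo hi)
cellsIn-suc-∈ R {lo} {hi} lo≤hi (bR<c , c≤aR) = begin
  (a R ⊓ suc hi) ∸ (b R ⊔ lo) ≡⟨ cong (_∸ (b R ⊔ lo)) (m≥n⇒m⊓n≡n c≤aR) ⟩
  suc hi ∸ (b R ⊔ lo)         ≡⟨ +-∸-assoc 1 (⊔-lub (≤-pred bR<c) lo≤hi) ⟩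
  suc (hi ∸ (b R ⊔ lo))       ≡⟨ cong (λ t → suc (t ∸ (b R ⊔ lo))) (sym (m≥n⇒m⊓n≡n (≤-trans (n≤1+n hi) c≤aR))) ⟩
  suc ((a R ⊓ hi) ∸ (b R ⊔ lo)) ∎
  where open ≡-Reasoning

cellsIn-suc-∉ : ∀ R {lo hi} → ¬ suc hi ∈ʳ R → cellsIn R lo (suc hi) ≡ cellsIn R lo hi
cellsIn-suc-∉ R {lo} {hi} c∉R with b R <? suc hi | suc hi ≤? a R
... | yes bR<c | yes c≤aR = contradiction (bR<c , c≤aR) c∉R
... | _        | no c≰aR  = cong (_∸ (b R ⊔ lo))
  (trans (m≤n⇒m⊓n≡m (≤-trans aR≤hi (n≤1+n hi))) (sym (m≤n⇒m⊓n≡m aR≤hi)))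
  where aR≤hi = ≤-pred (≰⇒> c≰aR)
... | no bR≮c  | yes _    = trans (cellsIn-empty R c≤) (sym (cellsIn-empty R (≤-trans (n≤1+n hi) c≤)))
  where c≤ = ≤-trans (≮⇒≥ bR≮c) (m≤m⊔n (b R) lo)

module _ (R : Row) {lo hi : ℕ} (meets : 0 < cellsIn R lo hi) where

  private
    ⊔<⊓ : b R ⊔ lo < a R ⊓ hi
    ⊔<⊓ = m∸n≢0⇒n<m (>⇒≢ meets)

  cellsIn>0⇒b<a : b R < a R
  cellsIn>0⇒b<a = ≤-<-trans (m≤m⊔n (b R) lo) (<-≤-trans ⊔<⊓ (m⊓n≤m (a R) hi))

  cellsIn>0⇒lo<a : lo < a R
  cellsIn>0⇒lo<a = ≤-<-trans (m≤n⊔m (b R) lo) (<-≤-trans ⊔<⊓ (m⊓n≤m (a R) hi))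

  cellsIn>0⇒b<hi : b R < hi
  cellsIn>0⇒b<hi = ≤-<-trans (m≤m⊔n (b R) lo) (<-≤-trans ⊔<⊓ (m⊓n≤n (a R) hi))

module _ {A : Set} (ρ : A → Row) where

  cellSum : ℕ → ℕ → List A → ℕ
  cellSum lo hi L = sum (map (λ i → cellsIn (ρ i) lo hi) L)

  cellSum-empty : ∀ {lo hi} L → hi ≤ lo → cellSum lo hi L ≡ 0
  cellSum-empty []      _     = refl
  cellSum-empty {lo} (i ∷ L) hi≤lo =
    cong₂ _+_ (cellsIn-empty (ρ i) (≤-trans hi≤lo (m≤n⊔m (b (ρ i)) lo))) (cellSum-empty L hi≤lo)

  cellSum-suc-∉ : ∀ {lo hi} L → All (λ i → ¬ suc hi ∈ʳ ρ i) L → cellSum lo (suc hi) L ≡ cellSum lo hi L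
  cellSum-suc-∉ []      []          = refl
  cellSum-suc-∉ (i ∷ L) (c∉i ∷ c∉L) = cong₂ _+_ (cellsIn-suc-∉ (ρ i) c∉i) (cellSum-suc-∉ L c∉L)

  cellSum-suc-≤ : ∀ {lo hi} L → lo ≤ hi → AllPairs (Disjoint on ρ) L →
                  cellSum lo (suc hi) L ≤ suc (cellSum lo hi L)
  cellSum-suc-≤ []      _     []              = z≤n
  cellSum-suc-≤ {lo} {hi} (i ∷ L) lo≤hi (i#L ∷ disjoint) with suc hi ∈ʳ? ρ i
  ... | yes c∈i = ≤-reflexive (cong₂ _+_ (cellsIn-suc-∈ (ρ i) lo≤hi c∈i)
                                        (cellSum-suc-∉ L (All.map (λ {j} i#j → Disjoint-∉ {ρ i} {ρ j} i#j c∈i) i#L)))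
  ... | no  c∉i = begin
    cellsIn (ρ i) lo (suc hi) + cellSum lo (suc hi) L ≡⟨ cong (_+ cellSum lo (suc hi) L) (cellsIn-suc-∉ (ρ i) c∉i) ⟩
    cellsIn (ρ i) lo hi + cellSum lo (suc hi) L       ≤⟨ +-monoʳ-≤ (cellsIn (ρ i) lo hi) (cellSum-suc-≤ L lo≤hi disjoint) ⟩
    cellsIn (ρ i) lo hi + suc (cellSum lo hi L)       ≡⟨ +-suc (cellsIn (ρ i) lo hi) (cellSum lo hi L) ⟩
    suc (cellsIn (ρ i) lo hi + cellSum lo hi L)       ∎
    where open ≤-Reasoning

  cellSum-≤-width : ∀ lo hi L → AllPairs (Disjoint on ρ) L → cellSum lo hi L ≤ hi ∸ lo
  cellSum-≤-width lo zero    L _ = ≤-trans (≤-reflexive (cellSum-empty L z≤n)) z≤n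
  cellSum-≤-width lo (suc hi) L disjoint with lo ≤? hi
  ... | yes lo≤hi = begin
    cellSum lo (suc hi) L ≤⟨ cellSum-suc-≤ L lo≤hi disjoint ⟩
    suc (cellSum lo hi L) ≤⟨ s≤s (cellSum-≤-width lo hi L disjoint) ⟩
    suc (hi ∸ lo)         ≡⟨ +-∸-assoc 1 lo≤hi ⟨
    suc hi ∸ lo           ∎
    where open ≤-Reasoning
  ... | no  lo≰hi = ≤-trans (≤-reflexive (cellSum-empty L (≰⇒> lo≰hi))) z≤n

  cellSum-<-width : ∀ lo c hi L → AllPairs (Disjoint on ρ) L → All (λ i → ¬ c ∈ʳ ρ i) L →
                    lo < c → c ≤ hi → cellSum lo hi L < hi ∸ lo
  cellSum-<-width lo c zero     L _        _   lo<c c≤0 = contradiction (<-≤-trans lo<c c≤0) (λ ())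
  cellSum-<-width lo c (suc hi) L disjoint c∉L lo<c c≤hi+1 with c ≟ suc hi
  ... | yes refl = begin-strict
    cellSum lo (suc hi) L ≡⟨ cellSum-suc-∉ L c∉L ⟩
    cellSum lo hi L       ≤⟨ cellSum-≤-width lo hi L disjoint ⟩
    hi ∸ lo               <⟨ n<1+n _ ⟩
    suc (hi ∸ lo)         ≡⟨ +-∸-assoc 1 (≤-pred lo<c) ⟨
    suc hi ∸ lo           ∎
    where open ≤-Reasoning
  ... | no  c≢hi+1 = begin-strict
    cellSum lo (suc hi) L ≤⟨ cellSum-suc-≤ L lo≤hi disjoint ⟩
    suc (cellSum lo hi L) <⟨ s≤s (cellSum-<-width lo c hi L disjoint c∉L lo<c c≤hi) ⟩
    suc (hi ∸ lo)         ≡⟨ +-∸-assoc 1 lo≤hi ⟨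
    suc hi ∸ lo           ∎
    where
    open ≤-Reasoning
    c≤hi  = ≤-pred (≤∧≢⇒< c≤hi+1 c≢hi+1)
    lo≤hi = ≤-trans (<⇒≤ lo<c) c≤hi

  cellSum≥width⇒covered : ∀ {lo hi L} → AllPairs (Disjoint on ρ) L → hi ∸ lo ≤ cellSum lo hi L →
                          ∀ {c} → lo < c → c ≤ hi → Any (λ i → c ∈ʳ ρ i) L
  cellSum≥width⇒covered {lo} {hi} {L} disjoint full {c} lo<c c≤hi with any? (λ i → c ∈ʳ? ρ i) L
  ... | yes covered = covered
  ... | no  uncovered = contradiction full
    (<⇒≱ (cellSum-<-width lo c hi L disjoint (¬Any⇒All¬ L uncovered) lo<c c≤hi))

  cellSum-≤-cellsIn : ∀ {lo hi} X {L} → All (λ i → ρ i ⊆ʳ X) L → AllPairs (Disjoint on ρ) L →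
                      cellSum lo hi L ≤ cellsIn X lo hi
  cellSum-≤-cellsIn {lo} {hi} X {L} inside disjoint = begin
    cellSum lo hi L                     ≡⟨ restrict L inside ⟩
    cellSum (b X ⊔ lo) (a X ⊓ hi) L     ≤⟨ cellSum-≤-width (b X ⊔ lo) (a X ⊓ hi) L disjoint ⟩
    cellsIn X lo hi                     ∎
    where
    open ≤-Reasoning
    restrict : ∀ L → All (λ i → ρ i ⊆ʳ X) L → cellSum lo hi L ≡ cellSum (b X ⊔ lo) (a X ⊓ hi) L
    restrict []      []            = refl
    restrict (i ∷ L) (i⊆X ∷ L⊆X) = cong₂ _+_ (cellsIn-restrict {ρ i} {X} lo hi i⊆X) (restrict L L⊆X)

  straddle-or-split : ∀ c L → AllPairs (λ y z → a (ρ y) ≤ b (ρ z)) L →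
    (∃ λ y → y ∈ L × b (ρ y) < c × c < a (ρ y))
    ⊎ (∃ λ p → ∃ λ s → L ≡ p ++ s × All (λ y → a (ρ y) ≤ c) p × All (λ z → c ≤ b (ρ z)) s)
  straddle-or-split c []      []               = inj₂ ([] , [] , refl , [] , [])
  straddle-or-split c (y ∷ L) (y≤L ∷ sorted) with a (ρ y) ≤? c
  ... | yes ay≤c with straddle-or-split c L sorted
  ...   | inj₁ (z , z∈ , straddles)            = inj₁ (z , there z∈ , straddles)
  ...   | inj₂ (p , s , refl , p≤c , c≤s)      = inj₂ (y ∷ p , s , refl , ay≤c ∷ p≤c , c≤s)
  straddle-or-split c (y ∷ L) (y≤L ∷ sorted) | no ay≰c with c ≤? b (ρ y)
  ... | yes c≤by = inj₂ ([] , y ∷ L , refl , [] , c≤by ∷ All.map (≤-trans (<⇒≤ (≰⇒> ay≰c))) y≤L)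
  ... | no  c≰by = inj₁ (y , here refl , ≰⇒> c≰by , ≰⇒> ay≰c)

module _ {n} (R : Strip n) {L : List (Fin n)} {lo hi : ℕ}
         (separated : OrderedPairs (λ j k → Separated (R j) (R k)) L)
         (meets : ∀ {j} → j ∈ L → 0 < cellsIn (R j) lo hi)
         (covered : ∀ {c} → lo < c → c ≤ hi → Any (λ m → c ∈ʳ R m) L) where

  private
    nonempty : ∀ {j} → j ∈ L → b (R j) < a (R j)
    nonempty j∈ = cellsIn>0⇒b<a (R _) (meets j∈)

  -- If R k lay left of R j, the cell b (R j) would be covered by a row that is neither
  -- before R j (induction on b (R j)) nor after it (separation).
  covering-sorted : OrderedPairs (λ j k → a (R j) ≤ b (R k)) L
  covering-sorted j∈ k∈ j<k = go _ j∈ k∈ j<k ≤-refl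
    where
    go : ∀ N {j k} → j ∈ L → k ∈ L → j Fin.< k → b (R j) < N → a (R j) ≤ b (R k)
    go (suc N) {j} {k} j∈ k∈ j<k bj<N with separated j∈ k∈ j<k
    ... | inj₁ aj≤bk = aj≤bk
    ... | inj₂ ak<bj with find (covered (<-trans (cellsIn>0⇒lo<a (R k) (meets k∈)) ak<bj)
                                        (<⇒≤ (cellsIn>0⇒b<hi (R j) (meets j∈))))
    ...   | m , m∈ , bm<bj , bj≤am with <ᶠ-cmp m j
    ...     | tri< m<j _ _ = contradiction (go N m∈ k∈ (<ᶠ-trans m<j j<k) (<-≤-trans bm<bj (≤-pred bj<N)))
                               (<⇒≱ (<-≤-trans (<-trans (nonempty k∈) ak<bj) bj≤am))
    ...     | tri≈ _ refl _ = contradiction bm<bj (<-irrefl refl)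
    ...     | tri> _ _ j<m with separated j∈ m∈ j<m
    ...       | inj₁ aj≤bm = contradiction (<-≤-trans (<-trans bm<bj (nonempty j∈)) aj≤bm)
                                          (<-irrefl refl)
    ...       | inj₂ am<bj = contradiction bj≤am (<⇒≱ am<bj)

-- The overlap M and the matrix Mat

M-≤ : ∀ R S → b R ≤ b S → M R S ≡ ∣ R ∩ S ∣
M-≤ R S bR≤bS with l R ≤? l S
... | yes _     = refl
... | no  bR≰bS = contradiction bR≤bS bR≰bS

M-> : ∀ R S → b S < b R → M R S ≡ ∣ R ∩ S ⁺ ∣
M-> R S bS<bR with l R ≤? l S
... | yes bR≤bS = contradiction bR≤bS (<⇒≱ bS<bR)
... | no  _     = refl

a≤b⇒M≡0 : ∀ R S → a R ≤ b S → M R S ≡ 0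
a≤b⇒M≡0 R S aR≤bS = trans (M-≤ R S (≤-trans (b≤a R) aR≤bS))
  (m≤n⇒m∸n≡0 (≤-trans (m⊓n≤m (a R) (a S)) (≤-trans aR≤bS (m≤n⊔m (b R) (b S)))))

private
  ⊓≤⇒≤ : ∀ m n {o} → m ⊓ n ≤ o → o < n → m ≤ o
  ⊓≤⇒≤ m n m⊓n≤o o<n with ≤-total m n
  ... | inj₁ m≤n = subst (_≤ _) (m≤n⇒m⊓n≡m m≤n) m⊓n≤o
  ... | inj₂ n≤m = contradiction (subst (_≤ _) (m≥n⇒m⊓n≡n n≤m) m⊓n≤o) (<⇒≱ o<n)

M≡0⇒Separated : ∀ R S → b R < a R → b S < a S → M R S ≡ 0 → Separated R S
M≡0⇒Separated R S bR<aR bS<aS M≡0 with b S <? b R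
... | no  bS≮bR = inj₁ (⊓≤⇒≤ (a R) (a S) (subst (a R ⊓ a S ≤_) (m≤n⇒m⊔n≡n bR≤bS) ⊓≤⊔) bS<aS)
  where
  bR≤bS = ≮⇒≥ bS≮bR
  ⊓≤⊔   = m∸n≡0⇒m≤n (trans (sym (M-≤ R S bR≤bS)) M≡0)
... | yes bS<bR =
  inj₂ (⊓≤⇒≤ (suc (a S)) (a R) (subst (_≤ b R) (⊓-comm (a R) (suc (a S))) ⊓≤bR) bR<aR)
  where ⊓≤bR = subst (a R ⊓ suc (a S) ≤_) (m≥n⇒m⊔n≡m bS<bR) (m∸n≡0⇒m≤n (trans (sym (M-> R S bS<bR)) M≡0))

module _ {n} (R : Strip n) where

  Mat-≤ : ∀ {i j} → toℕ i ≤ toℕ j → Mat R i j ≡ M (R i) (R j)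
  Mat-≤ {i} {j} i≤j with toℕ i ≤? toℕ j
  ... | yes _   = refl
  ... | no  i≰j = contradiction i≤j i≰j

  Mat-> : ∀ {i j} → toℕ j < toℕ i → Mat R i j ≡ M (R j) (R i)
  Mat-> {i} {j} j<i with toℕ i ≤? toℕ j
  ... | yes i≤j = contradiction i≤j (<⇒≱ j<i)
  ... | no  _   = refl

  Mat-sym : ∀ i j → Mat R i j ≡ Mat R j i
  Mat-sym i j with <ᶠ-cmp i j
  ... | tri< i<j _ _ = trans (Mat-≤ (<⇒≤ i<j)) (sym (Mat-> i<j))
  ... | tri≈ _ refl _ = refl
  ... | tri> _ _ j<i = trans (Mat-> j<i) (sym (Mat-≤ (<⇒≤ j<i)))

  a≤b⇒Mat≡0 : ∀ {i j} → i Fin.< j → a (R i) ≤ b (R j) → Mat R i j ≡ 0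
  a≤b⇒Mat≡0 i<j aᵢ≤bⱼ = trans (Mat-≤ (<⇒≤ i<j)) (a≤b⇒M≡0 (R _) (R _) aᵢ≤bⱼ)

  overlap⇒StrictPair : ∀ {x y} → x Fin.< y → b (R x) < b (R y) → b (R y) < a (R x) → a (R x) < a (R y) →
                       StrictPair R x y
  overlap⇒StrictPair {x} {y} x<y bx<by by<ax ax<ay = x<y , bx<by , inj₁
    ( subst (0 <_) (sym Mat≡) (m<n⇒0<n∸m by<ax)
    , subst (_< ∣ R x ∣ᵣ ⊓ ∣ R y ∣ᵣ) (sym Mat≡)
        (⊓-glb (∸-monoʳ-< bx<by (<⇒≤ by<ax)) (∸-monoˡ-< ax<ay (<⇒≤ by<ax))) )
    where
    Mat≡ : Mat R x y ≡ a (R x) ∸ b (R y)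
    Mat≡ = trans (Mat-≤ (<⇒≤ x<y)) (trans (M-≤ (R x) (R y) (<⇒≤ bx<by))
             (cong₂ _∸_ (m≤n⇒m⊓n≡m (<⇒≤ ax<ay)) (m≤n⇒m⊔n≡n (<⇒≤ bx<by))))

  -- With a common left end, x ≺ v just says R x ⊆ R v.
  ¬≺⇒a<a : ∀ {x v} → x Fin.< v → l (R x) ≡ l (R v) → ¬ (R ⊢ x ≺ v) → a (R v) < a (R x)
  ¬≺⇒a<a {x} {v} x<v bx≡bv x⊀v = ≰⇒> λ ax≤av → x⊀v (begin
    Mat R x v                        ≡⟨ Mat-≤ (<⇒≤ x<v) ⟩
    M (R x) (R v)                    ≡⟨ M-≤ (R x) (R v) (≤-reflexive bx≡bv) ⟩
    (a (R x) ⊓ a (R v)) ∸ (b (R x) ⊔ b (R v)) ≡⟨ cong₂ _∸_ (m≤n⇒m⊓n≡m ax≤av) (m≤n⇒m⊔n≡n (≤-reflexive bx≡bv)) ⟩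
    a (R x) ∸ b (R v)                ≡⟨ cong (a (R x) ∸_) bx≡bv ⟨
    ∣ R x ∣ᵣ                         ∎)
    where open ≡-Reasoning

-- Windows of witness rows

M≡cellsIn-before : ∀ S H → b H < b S → M S H ≡ cellsIn S (b H) (suc (a H))
M≡cellsIn-before S H bH<bS = trans (M-> S H bH<bS) (cellsIn-lo-irrelevant S bH<bS (<⇒≤ bH<bS))

M≤cellsIn-before : ∀ S H → M S H ≤ cellsIn S (b H) (suc (a H))
M≤cellsIn-before S H with b H <? b S
... | yes bH<bS = ≤-reflexive (M≡cellsIn-before S H bH<bS)
... | no  bH≮bS = ≤-trans (≤-reflexive (M-≤ S H (≮⇒≥ bH≮bS))) (cellsIn-mono-hi S (n≤1+n (a H)))

M≡cellsIn-after : ∀ H S → b H ≤ b S → M H S ≡ cellsIn S (pred (b H)) (a H)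
M≡cellsIn-after H S bH≤bS = begin
  M H S                      ≡⟨ M-≤ H S bH≤bS ⟩
  ∣ H ∩ S ∣                  ≡⟨ ∩-comm H S ⟩
  cellsIn S (b H) (a H)      ≡⟨ cellsIn-lo-irrelevant S bH≤bS (≤-trans pred[n]≤n bH≤bS) ⟩
  cellsIn S (pred (b H)) (a H) ∎
  where open ≡-Reasoning

M≤cellsIn-after : ∀ H S → M H S ≤ cellsIn S (pred (b H)) (a H)
M≤cellsIn-after H S with b S <? b H
... | no  bS≮bH = ≤-reflexive (M≡cellsIn-after H S (≮⇒≥ bS≮bH))
... | yes bS<bH = begin
  M H S                                      ≡⟨ M-> H S bS<bH ⟩
  (a H ⊓ suc (a S)) ∸ (b H ⊔ suc (b S))      ≡⟨ cong ((a H ⊓ suc (a S)) ∸_) (m≥n⇒m⊔n≡m bS<bH) ⟩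
  (a H ⊓ suc (a S)) ∸ b H                    ≤⟨ ∸-monoˡ-≤ (b H) (⊓-monoˡ-≤ (suc (a S)) (n≤1+n (a H))) ⟩
  suc (a H ⊓ a S) ∸ b H                      ≡⟨ suc-∸ (a H ⊓ a S) (m<n⇒0<n bS<bH) ⟩
  (a H ⊓ a S) ∸ pred (b H)                   ≡⟨ cong₂ _∸_ (⊓-comm (a H) (a S))
                                                           (sym (m≤n⇒m⊔n≡n (suc[m]≤n⇒m≤pred[n] bS<bH))) ⟩
  cellsIn S (pred (b H)) (a H)               ∎
  where
  open ≤-Reasoning
  suc-∸ : ∀ m {k} → 0 < k → suc m ∸ k ≡ m ∸ pred k
  suc-∸ m {suc k} _ = refl

∸-pred-≤ : ∀ m n → m ∸ pred n ≤ m ∸ n + 1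
∸-pred-≤ m       zero          = m≤m+n m 1
∸-pred-≤ zero    (suc n)       = ≤-trans (≤-reflexive (0∸n≡0 n)) z≤n
∸-pred-≤ (suc m) (suc zero)    = ≤-reflexive (+-comm 1 m)
∸-pred-≤ (suc m) (suc (suc n)) = ∸-pred-≤ m (suc n)

-- Rows on the Side of h meet it in at most their cells in a window of |R h| + 1 cells
-- (R h plus the neighbouring cell on that side), exactly so if they start inside the window.
record Window {n} (R : Strip n) (h : Fin n) (Side : Fin n → Set) : Set where
  field
    lo hi       : ℕ
    width≤      : hi ∸ lo ≤ ∣ R h ∣ᵣ + 1
    Mat≤cellsIn : ∀ {j} → Side j → Mat R j h ≤ cellsIn (R j) lo hi
    Mat≡cellsIn : ∀ {j} → Side j → lo < b (R j) → Mat R j h ≡ cellsIn (R j) lo hi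
    between     : ∀ {u x v} → Side u → Side v → u Fin.< x → x Fin.< v → Side x
    oneSide     : ∀ {L} → All Side L → All (h Fin.<_) L ⊎ All (Fin._< h) L

windowBefore : ∀ {n} (R : Strip n) h → Window R h (Fin._< h)
windowBefore R h = record
  { lo          = b (R h)
  ; hi          = suc (a (R h))
  ; width≤      = ≤-reflexive (trans (+-∸-assoc 1 (b≤a (R h))) (+-comm 1 (∣ R h ∣ᵣ)))
  ; Mat≤cellsIn = λ {j} j<h → ≤-trans (≤-reflexive (Mat-≤ R (<⇒≤ j<h))) (M≤cellsIn-before (R j) (R h))
  ; Mat≡cellsIn = λ {j} j<h bh<bj → trans (Mat-≤ R (<⇒≤ j<h)) (M≡cellsIn-before (R j) (R h) bh<bj)
  ; between     = λ _ v<h _ x<v → <ᶠ-trans x<v v<h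
  ; oneSide     = inj₂
  }

windowAfter : ∀ {n} (R : Strip n) h → Window R h (h Fin.<_)
windowAfter R h = record
  { lo          = pred (b (R h))
  ; hi          = a (R h)
  ; width≤      = ∸-pred-≤ (a (R h)) (b (R h))
  ; Mat≤cellsIn = λ {j} h<j → ≤-trans (≤-reflexive (Mat-> R h<j)) (M≤cellsIn-after (R h) (R j))
  ; Mat≡cellsIn = λ {j} h<j lo<bj → trans (Mat-> R h<j) (M≡cellsIn-after (R h) (R j) (pred<⇒≤ lo<bj))
  ; between     = λ h<u _ u<x _ → <ᶠ-trans h<u u<x
  ; oneSide     = inj₁
  }
  where
  pred<⇒≤ : ∀ {m k} → pred m < k → m ≤ k
  pred<⇒≤ {zero}  _ = z≤n
  pred<⇒≤ {suc _} p = p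

record StrictVia {n} {R : Strip n} {h : Fin n} {Side : Fin n → Set}
                 (W : Window R h Side) (js : List (Fin n)) : Set where
  constructor strictVia
  field
    chain : Linked Fin._<_ js
    zeros : AllPairs (λ i j → Mat R i j ≡ 0) js
    sides : All Side js
    pos   : All (λ j → 0 < Mat R j h) js
    total : ∣ R h ∣ᵣ + 1 ≤ sum (map (λ j → Mat R j h) js)

StrictVia⇒StrictSeq : ∀ {n} {R : Strip n} {h Side} {W : Window R h Side} {js} →
                      2 ≤ length js → StrictVia W js → StrictSeq R js
StrictVia⇒StrictSeq {h = h} {W = W} 2≤len (strictVia chain zeros sides pos total) =
  2≤len , chain , zeros , h , Window.oneSide W sides , pos , total

module Tiling {n} {R : Strip n} {h Side} {W : Window R h Side} {js} (S : StrictVia W js) where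
  open Window W
  open StrictVia S

  increasing : AllPairs Fin._<_ js
  increasing = Linked⇒AllPairs <ᶠ-trans chain

  meets : ∀ {j} → j ∈ js → 0 < cellsIn (R j) lo hi
  meets j∈ = <-≤-trans (All.lookup pos j∈) (Mat≤cellsIn (All.lookup sides j∈))

  nonempty : ∀ {j} → j ∈ js → b (R j) < a (R j)
  nonempty j∈ = cellsIn>0⇒b<a (R _) (meets j∈)

  separated : OrderedPairs (λ j k → Separated (R j) (R k)) js
  separated j∈ k∈ j<k = M≡0⇒Separated (R _) (R _) (nonempty j∈) (nonempty k∈)
    (trans (sym (Mat-≤ R (<⇒≤ j<k))) (AllPairs⇒OrderedPairs increasing zeros j∈ k∈ j<k))

  disjoint : AllPairs (Disjoint on R) js
  disjoint = OrderedPairs⇒AllPairs increasing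
    (λ j∈ k∈ j<k → Separated⇒Disjoint (R _) (R _) (separated j∈ k∈ j<k))

  covered : ∀ {c} → lo < c → c ≤ hi → Any (λ m → c ∈ʳ R m) js
  covered = cellSum≥width⇒covered R disjoint (begin
    hi ∸ lo                              ≤⟨ width≤ ⟩
    ∣ R h ∣ᵣ + 1                         ≤⟨ total ⟩
    sum (map (λ j → Mat R j h) js)       ≤⟨ sum-map-mono (All.map Mat≤cellsIn sides) ⟩
    cellSum R lo hi js                   ∎)
    where open ≤-Reasoning

  sorted : OrderedPairs (λ j k → a (R j) ≤ b (R k)) js
  sorted = covering-sorted R separated meets covered

module AtPair {n} {R : Strip n} {h Side} {W : Window R h Side} {pre post u v}
              (S : StrictVia W (pre ++ u ∷ v ∷ post)) where
  open Tiling S public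

  u∈ : u ∈ pre ++ u ∷ v ∷ post
  u∈ = ∈-++⁺ʳ pre (here refl)

  v∈ : v ∈ pre ++ u ∷ v ∷ post
  v∈ = ∈-++⁺ʳ pre (there (here refl))

  post⊆ : ∀ {y} → y ∈ post → y ∈ pre ++ u ∷ v ∷ post
  post⊆ y∈ = ∈-++⁺ʳ pre (there (there y∈))

  pre<u : All (Fin._< u) pre
  pre<u = AllPairs-++-middle pre increasing

  u<v : u Fin.< v
  u<v = All.head (AllPairs.head (AllPairs-++⁻ʳ pre increasing))

  v<post : All (v Fin.<_) post
  v<post = AllPairs.head (AllPairs.tail (AllPairs-++⁻ʳ pre increasing))

  post-sorted : AllPairs (λ y z → a (R y) ≤ b (R z)) post
  post-sorted = OrderedPairs⇒AllPairs (AllPairs.tail (AllPairs.tail (AllPairs-++⁻ʳ pre increasing)))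
    (λ y∈ z∈ y<z → sorted (post⊆ y∈) (post⊆ z∈) y<z)

  v-before-post : ∀ {y} → y ∈ post → a (R v) ≤ b (R y)
  v-before-post y∈ = sorted v∈ (post⊆ y∈) (All.lookup v<post y∈)

-- Replacing R v and the rows inside R x by R x

module _ {n} {R : Strip n} {h Side} (W : Window R h Side) where
  open Window W

  StrictVia-replace : ∀ pre p s {u v x} → StrictVia W (pre ++ u ∷ v ∷ p ++ s) →
    u Fin.< x → x Fin.< v → l (R x) ≡ l (R v) → ¬ (R ⊢ x ≺ v) →
    All (λ y → a (R y) ≤ a (R x)) p → All (λ z → a (R x) ≤ b (R z)) s →
    StrictVia W (pre ++ u ∷ x ∷ s)
  StrictVia-replace pre p s {u} {v} {x} S u<x x<v bx≡bv x⊀v p≤x x≤s =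
    strictVia chain′ zeros′ (All-replace pre p s sides side-x) (All-replace pre p s pos 0<fx) total′
    where
    open StrictVia S
    open AtPair S

    f : Fin n → ℕ
    f j = Mat R j h

    side-x : Side x
    side-x = between (All.lookup sides u∈) (All.lookup sides v∈) u<x x<v

    lo<bx : lo < b (R x)
    lo<bx = <-≤-trans (cellsIn>0⇒lo<a (R u) (meets u∈))
                      (subst (a (R u) ≤_) (sym bx≡bv) (sorted u∈ v∈ u<v))

    vp⊆x : All (λ j → R j ⊆ʳ R x) (v ∷ p)
    vp⊆x = (≤-reflexive bx≡bv , <⇒≤ (¬≺⇒a<a R x<v bx≡bv x⊀v))
         ∷ All.tabulate (λ j∈ → ≤-trans (≤-reflexive bx≡bv)
                                  (≤-trans (<⇒≤ (nonempty v∈)) (v-before-post (∈-++⁺ˡ j∈)))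
                              , All.lookup p≤x j∈)

    absorbed : f v + sum (map f p) ≤ f x
    absorbed = begin
      sum (map f (v ∷ p))     ≤⟨ sum-map-mono (All.map Mat≤cellsIn (All.++⁻ˡ (v ∷ p) (All.tail (All.++⁻ʳ pre sides)))) ⟩
      cellSum R lo hi (v ∷ p) ≤⟨ cellSum-≤-cellsIn R (R x) vp⊆x
                                   (AllPairs-++⁻ˡ (v ∷ p) (AllPairs.tail (AllPairs-++⁻ʳ pre disjoint))) ⟩
      cellsIn (R x) lo hi     ≡⟨ Mat≡cellsIn side-x lo<bx ⟨
      f x                     ∎
      where open ≤-Reasoning

    0<fx : 0 < f x
    0<fx = <-≤-trans (All.lookup pos v∈) (≤-trans (m≤m+n (f v) (sum (map f p))) absorbed)

    chain′ : Linked Fin._<_ (pre ++ u ∷ x ∷ s)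
    chain′ = Linked-replace <ᶠ-trans pre p s chain u<x x<v

    before-x : ∀ {w} → w ∈ pre ++ u ∷ v ∷ p ++ s → w Fin.< x → Mat R w x ≡ 0
    before-x w∈ w<x = a≤b⇒Mat≡0 R w<x (subst (a (R _) ≤_) (sym bx≡bv) (sorted w∈ v∈ (<ᶠ-trans w<x x<v)))

    classify : ∀ {w} → w ∈ pre ++ u ∷ x ∷ s → w ≡ x ⊎ (w ∈ pre ++ u ∷ v ∷ p ++ s × Mat R w x ≡ 0)
    classify w∈ with ∈-++⁻ pre w∈
    ... | inj₁ w∈pre               =
      inj₂ (∈-++⁺ˡ w∈pre , before-x (∈-++⁺ˡ w∈pre) (<ᶠ-trans (All.lookup pre<u w∈pre) u<x))
    ... | inj₂ (here refl)         = inj₂ (u∈ , before-x u∈ u<x)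
    ... | inj₂ (there (here refl)) = inj₁ refl
    ... | inj₂ (there (there w∈s)) =
      inj₂ (post⊆ (∈-++⁺ʳ p w∈s) , trans (Mat-sym R _ x) (a≤b⇒Mat≡0 R x<w (All.lookup x≤s w∈s)))
      where x<w = <ᶠ-trans x<v (All.lookup v<post (∈-++⁺ʳ p w∈s))

    zeros′ : AllPairs (λ i j → Mat R i j ≡ 0) (pre ++ u ∷ x ∷ s)
    zeros′ = OrderedPairs⇒AllPairs (Linked⇒AllPairs <ᶠ-trans chain′) zero-pair
      where
      zero-pair : OrderedPairs (λ i j → Mat R i j ≡ 0) (pre ++ u ∷ x ∷ s)
      zero-pair i∈ j∈ i<j with classify i∈ | classify j∈
      ... | inj₁ refl        | inj₁ refl        = contradiction i<j (<-irrefl refl)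
      ... | inj₁ refl        | inj₂ (_ , jx≡0)  = trans (Mat-sym R x _) jx≡0
      ... | inj₂ (_ , ix≡0)  | inj₁ refl        = ix≡0
      ... | inj₂ (i∈′ , _)   | inj₂ (j∈′ , _)   = AllPairs⇒OrderedPairs increasing zeros i∈′ j∈′ i<j

    total′ : ∣ R h ∣ᵣ + 1 ≤ sum (map f (pre ++ u ∷ x ∷ s))
    total′ = begin
      ∣ R h ∣ᵣ + 1                                          ≤⟨ total ⟩
      sum (map f (pre ++ u ∷ v ∷ p ++ s))                   ≡⟨ sum-map-++ f pre (u ∷ v ∷ p ++ s) ⟩
      F + (f u + (f v + sum (map f (p ++ s))))              ≡⟨ cong (λ t → F + (f u + (f v + t))) (sum-map-++ f p s) ⟩
      F + (f u + (f v + (sum (map f p) + sum (map f s))))   ≡⟨ cong (λ t → F + (f u + t)) (+-assoc (f v) _ _) ⟨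
      F + (f u + (f v + sum (map f p) + sum (map f s)))     ≤⟨ +-monoʳ-≤ F (+-monoʳ-≤ (f u) (+-monoˡ-≤ _ absorbed)) ⟩
      F + (f u + (f x + sum (map f s)))                     ≡⟨ sum-map-++ f pre (u ∷ x ∷ s) ⟨
      sum (map f (pre ++ u ∷ x ∷ s))                        ∎
      where
      open ≤-Reasoning
      F = sum (map f pre)

  replace-or-strictPair : ∀ pre post {u v x} → StrictVia W (pre ++ u ∷ v ∷ post) →
    u Fin.< x → x Fin.< v → l (R x) ≡ l (R v) → ¬ (R ⊢ x ≺ v) →
    StrictSeq R (pre ++ u ∷ x ∷ [])
    ⊎ (∃ λ p → ∃ λ s → (post ≡ p ++ s) × (s ≢ []) × StrictSeq R (pre ++ u ∷ x ∷ s))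
    ⊎ (∃ λ y → (y ∈ post) × StrictPair R x y)
  replace-or-strictPair pre post {u} {v} {x} S u<x x<v bx≡bv x⊀v
    with straddle-or-split R (a (R x)) post (AtPair.post-sorted S)
  ... | inj₁ (y , y∈ , by<ax , ax<ay) =
    inj₂ (inj₂ (y , y∈ , overlap⇒StrictPair R (<ᶠ-trans x<v (All.lookup v<post y∈)) bx<by by<ax ax<ay))
    where
    open AtPair S
    bx<by = <-≤-trans (subst (_< a (R v)) (sym bx≡bv) (nonempty v∈)) (v-before-post y∈)
  ... | inj₂ (p , [] , refl , p≤x , x≤s) =
    inj₁ (StrictVia⇒StrictSeq (length-≥2 pre []) (StrictVia-replace pre p [] S u<x x<v bx≡bv x⊀v p≤x x≤s))
  ... | inj₂ (p , s@(_ ∷ _) , refl , p≤x , x≤s) =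
    inj₂ (inj₁ (p , s , refl , (λ ()) ,
      StrictVia⇒StrictSeq (length-≥2 pre s) (StrictVia-replace pre p s S u<x x<v bx≡bv x⊀v p≤x x≤s)))

proposition5p34 : ∀ {n} (R : Strip n) (pre post : List (Fin n)) (u v x : Fin n) →
    StrictSeq R (pre ++ u ∷ v ∷ post) →
    u Fin.< x → x Fin.< v → l (R x) ≡ l (R v) → R ⊢ v ≺≁ x →
    StrictSeq R (pre ++ u ∷ x ∷ [])
    ⊎ (∃ λ p → ∃ λ s → (post ≡ p ++ s) × (s ≢ []) × StrictSeq R (pre ++ u ∷ x ∷ s))
    ⊎ (∃ λ y → (y ∈ post) × StrictPair R x y)
proposition5p34 R pre post u v x (_ , chain , zeros , h , inj₁ h<js , pos , total) u<x x<v bx≡bv (_ , x⊀v) =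
  replace-or-strictPair (windowAfter R h) pre post (strictVia chain zeros h<js pos total) u<x x<v bx≡bv x⊀v
proposition5p34 R pre post u v x (_ , chain , zeros , h , inj₂ js<h , pos , total) u<x x<v bx≡bv (_ , x⊀v) =
  replace-or-strictPair (windowBefore R h) pre post (strictVia chain zeros js<h pos total) u<x x<v bx≡bv x⊀v
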